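{- Let $R$ be a unital ring and $M_R$ a right $R$-module. For each $q\geq 2$, $(GL_q(R)^{op}\ltimes M^q)^{ab}\cong GL_q(R)^{ab}$. Moreover, if $1\in R$ can be written as a sum of two units of $R$, then the same conclusion holds for $q=1$.
   Context: In the semidirect product $GL_q(R)^{op}\ltimes M^q$, the group $GL_q(R)^{op}$ acts on $M^q$ (viewed as row vectors) on the right by matrix multiplication. $G^{ab}$ denotes the abelianization of a group $G$. -}

module Defs where

open import Level using (Level; _⊔_)
open import Data.Nat using (ℕ)
import Data.Nat as ℕ
open import Data.Fin using (Fin; zero; suc)
open import Data.Product using (Σ; ∃; _×_; _,_)
open import Relation.Nullary using (¬_)
open import Algebra.Bundles using (Ring)
open import Algebra.Bundles.Raw using (RawGroup)
open import Algebra.Module.Bundles using (RightModule)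
import Algebra.Definitions.RawMonoid as RawMonoidDefs
import Algebra.Morphism.Structures as MorphismStructures

private variable a ℓ r ℓr m ℓm : Level

-- Abelianization of a (raw) group: same carrier, equality replaced by
-- the smallest congruence containing the original equality and all
-- relations x ∙ y ~ y ∙ x.  For a group G this is exactly G / [G,G].

module _ (G : RawGroup a ℓ) where
  open RawGroup G

  data AbEq : Carrier → Carrier → Set (a ⊔ ℓ) where
    base   : ∀ {x y} → x ≈ y → AbEq x y
    comm   : ∀ x y → AbEq (x ∙ y) (y ∙ x)
    ab-refl  : ∀ {x} → AbEq x x
    ab-sym   : ∀ {x y} → AbEq x y → AbEq y x
    ab-trans : ∀ {x y z} → AbEq x y → AbEq y z → AbEq x z
    ab-∙     : ∀ {x x′ y y′} → AbEq x x′ → AbEq y y′ → AbEq (x ∙ y) (x′ ∙ y′)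
    ab-⁻¹    : ∀ {x x′} → AbEq x x′ → AbEq (x ⁻¹) (x′ ⁻¹)

  Abelianization : RawGroup a (a ⊔ ℓ)
  Abelianization = record
    { Carrier = Carrier ; _≈_ = AbEq ; _∙_ = _∙_ ; ε = ε ; _⁻¹ = _⁻¹ }

_≅ᴳ_ : ∀ {a b ℓ₁ ℓ₂} → RawGroup a ℓ₁ → RawGroup b ℓ₂ → Set (a ⊔ b ⊔ ℓ₁ ⊔ ℓ₂)
G ≅ᴳ H = ∃ λ f → MorphismStructures.GroupMorphisms.IsGroupIsomorphism G H f

module Matrices (R : Ring r ℓr) where
  open Ring R hiding (zero)
  open import Algebra.Properties.Semiring.Sum semiring
    using (sum; sum-cong-≋; sum-replicate-zero; ∑-comm; *-distribˡ-sum; *-distribʳ-sum)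
  open import Relation.Binary.Reasoning.Setoid setoid

  Matrix : ℕ → Set r
  Matrix q = Fin q → Fin q → Carrier

  _⊗_ : ∀ {q} → Matrix q → Matrix q → Matrix q
  (A ⊗ B) i j = sum (λ k → A i k * B k j)

  𝟙 : ∀ {q} → Matrix q
  𝟙 zero    zero    = 1#
  𝟙 zero    (suc _) = 0#
  𝟙 (suc _) zero    = 0#
  𝟙 (suc i) (suc j) = 𝟙 i j

  _≈ₘ_ : ∀ {q} → Matrix q → Matrix q → Set ℓr
  A ≈ₘ B = ∀ i j → A i j ≈ B i j

  ≈ₘ-sym : ∀ {q} {A B : Matrix q} → A ≈ₘ B → B ≈ₘ A
  ≈ₘ-sym p i j = sym (p i j)

  ≈ₘ-trans : ∀ {q} {A B C : Matrix q} → A ≈ₘ B → B ≈ₘ C → A ≈ₘ C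
  ≈ₘ-trans p p′ i j = trans (p i j) (p′ i j)

  ⊗-cong : ∀ {q} {A A′ B B′ : Matrix q} → A ≈ₘ A′ → B ≈ₘ B′ → (A ⊗ B) ≈ₘ (A′ ⊗ B′)
  ⊗-cong p p′ i j = sum-cong-≋ (λ k → *-cong (p i k) (p′ k j))

  ⊗-assoc : ∀ {q} (A B C : Matrix q) → ((A ⊗ B) ⊗ C) ≈ₘ (A ⊗ (B ⊗ C))
  ⊗-assoc A B C i j = begin
    sum (λ l → sum (λ k → A i k * B k l) * C l j)
      ≈⟨ sum-cong-≋ (λ l → *-distribʳ-sum (C l j) (λ k → A i k * B k l)) ⟩
    sum (λ l → sum (λ k → (A i k * B k l) * C l j))
      ≈⟨ sum-cong-≋ (λ l → sum-cong-≋ (λ k → *-assoc (A i k) (B k l) (C l j))) ⟩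
    sum (λ l → sum (λ k → A i k * (B k l * C l j)))
      ≈⟨ ∑-comm (λ l k → A i k * (B k l * C l j)) ⟩
    sum (λ k → sum (λ l → A i k * (B k l * C l j)))
      ≈⟨ sum-cong-≋ (λ k → sym (*-distribˡ-sum (A i k) (λ l → B k l * C l j))) ⟩
    sum (λ k → A i k * sum (λ l → B k l * C l j)) ∎

  private
    sum-0 : ∀ {q} (f : Fin q → Carrier) → (∀ k → f k ≈ 0#) → sum f ≈ 0#
    sum-0 {q} f p = trans (sum-cong-≋ p) (sum-replicate-zero q)

    rowδ : ∀ {q} (v : Fin q → Carrier) j → sum (λ k → v k * 𝟙 k j) ≈ v j
    rowδ {ℕ.suc q} v zero = begin
      v zero * 1# + sum (λ k → v (suc k) * 0#)
        ≈⟨ +-cong (*-identityʳ _) (sum-0 (λ k → v (suc k) * 0#) (λ k → zeroʳ _)) ⟩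
      v zero + 0#  ≈⟨ +-identityʳ _ ⟩
      v zero ∎
    rowδ {ℕ.suc q} v (suc j) = begin
      v zero * 0# + sum (λ k → v (suc k) * 𝟙 k j)
        ≈⟨ +-cong (zeroʳ _) (rowδ (λ k → v (suc k)) j) ⟩
      0# + v (suc j)  ≈⟨ +-identityˡ _ ⟩
      v (suc j) ∎

    colδ : ∀ {q} (v : Fin q → Carrier) i → sum (λ k → 𝟙 i k * v k) ≈ v i
    colδ {ℕ.suc q} v zero = begin
      1# * v zero + sum (λ k → 0# * v (suc k))
        ≈⟨ +-cong (*-identityˡ _) (sum-0 (λ k → 0# * v (suc k)) (λ k → zeroˡ _)) ⟩
      v zero + 0#  ≈⟨ +-identityʳ _ ⟩
      v zero ∎
    colδ {ℕ.suc q} v (suc i) = begin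
      0# * v zero + sum (λ k → 𝟙 i k * v (suc k))
        ≈⟨ +-cong (zeroˡ _) (colδ (λ k → v (suc k)) i) ⟩
      0# + v (suc i)  ≈⟨ +-identityˡ _ ⟩
      v (suc i) ∎

  ⊗-identityʳ : ∀ {q} (A : Matrix q) → (A ⊗ 𝟙) ≈ₘ A
  ⊗-identityʳ A i j = rowδ (A i) j

  ⊗-identityˡ : ∀ {q} (A : Matrix q) → (𝟙 ⊗ A) ≈ₘ A
  ⊗-identityˡ A i j = colδ (λ k → A k j) i

  ⊗-inv : ∀ {q} (A A′ B B′ : Matrix q) → (A ⊗ A′) ≈ₘ 𝟙 → (B ⊗ B′) ≈ₘ 𝟙 →
          ((A ⊗ B) ⊗ (B′ ⊗ A′)) ≈ₘ 𝟙
  ⊗-inv A A′ B B′ p p′ =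
    ≈ₘ-trans (⊗-assoc A B (B′ ⊗ A′))
    (≈ₘ-trans (⊗-cong {A = A} (λ _ _ → refl) (≈ₘ-sym (⊗-assoc B B′ A′)))
    (≈ₘ-trans (⊗-cong {A = A} (λ _ _ → refl) (⊗-cong p′ (λ _ _ → refl)))
    (≈ₘ-trans (⊗-cong {A = A} (λ _ _ → refl) (⊗-identityˡ A′)) p)))

  record GLElem (q : ℕ) : Set (r ⊔ ℓr) where
    constructor mkGL
    field
      mat  : Matrix q
      inv  : Matrix q
      invʳ : (mat ⊗ inv) ≈ₘ 𝟙
      invˡ : (inv ⊗ mat) ≈ₘ 𝟙
  open GLElem public

  _·GL_ : ∀ {q} → GLElem q → GLElem q → GLElem q
  A ·GL B = mkGL (mat A ⊗ mat B) (inv B ⊗ inv A)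
                 (⊗-inv (mat A) (inv A) (mat B) (inv B) (invʳ A) (invʳ B))
                 (⊗-inv (inv B) (mat B) (inv A) (mat A) (invˡ B) (invˡ A))

  1GL : ∀ {q} → GLElem q
  1GL = mkGL 𝟙 𝟙 (⊗-identityʳ 𝟙) (⊗-identityʳ 𝟙)

  _⁻¹GL : ∀ {q} → GLElem q → GLElem q
  A ⁻¹GL = mkGL (inv A) (mat A) (invˡ A) (invʳ A)

  GL : ℕ → RawGroup (r ⊔ ℓr) ℓr
  GL q = record
    { Carrier = GLElem q
    ; _≈_ = λ A B → mat A ≈ₘ mat B
    ; _∙_ = _·GL_
    ; ε = 1GL
    ; _⁻¹ = _⁻¹GL
    }

  IsUnit : Carrier → Set (r ⊔ ℓr)
  IsUnit u = ∃ λ w → (u * w ≈ 1#) × (w * u ≈ 1#)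

  OneIsSumOfTwoUnits : Set (r ⊔ ℓr)
  OneIsSumOfTwoUnits = ∃ λ u → ∃ λ v → IsUnit u × IsUnit v × (u + v ≈ 1#)

-- Elements of M^q are row vectors v : Fin q → M; a matrix A acts on the
-- right by (v·A)ⱼ = Σₖ vₖ Aₖⱼ.  Right action of GL_q(R) = left action of
-- GL_q(R)^op (A ▷ v = v·A), so with A ∗ B = B A the product in GL^op,
--   (A , v) (B , w) = (A ∗ B , v + A ▷ w) = (B A , v + w·A).

module SemiDirect (R : Ring r ℓr) (M : RightModule R m ℓm) where
  open Ring R using () renaming (Carrier to Rc)
  open Matrices R
  open RightModule M
  open RawMonoidDefs +ᴹ-rawMonoid using () renaming (sum to sumᴹ)

  _·ᵥ_ : ∀ {q} → (Fin q → Carrierᴹ) → Matrix q → (Fin q → Carrierᴹ)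
  (v ·ᵥ A) j = sumᴹ (λ k → v k *ᵣ A k j)

  SD : ℕ → RawGroup (r ⊔ ℓr ⊔ m) (ℓr ⊔ ℓm)
  SD q = record
    { Carrier = GLElem q × (Fin q → Carrierᴹ)
    ; _≈_ = λ { (A , v) (B , w) → (mat A ≈ₘ mat B) × (∀ j → v j ≈ᴹ w j) }
    ; _∙_ = λ { (A , v) (B , w) → (B ·GL A , λ j → v j +ᴹ (w ·ᵥ mat A) j) }
    ; ε = (1GL , λ _ → 0ᴹ)
    ; _⁻¹ = λ { (A , v) → (A ⁻¹GL , λ j → -ᴹ (v ·ᵥ inv A) j) }
    }

{-# OPTIONS --safe #-}
module Submission where

-- Every (A, v) is the product of the translation (1, v) and (A, 0), so once
-- all translations vanish in the abelianization, (A, v) ↦ A is injective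
-- there.  Conjugation becomes trivial, so (1, v·B) ~ (1, v): the translation
-- by v·B − v vanishes for every B ∈ GL_q(R).  For q ≥ 2 and i ≠ j the
-- transvection B = 1 + e_ij gives x·e_i·B − x·e_i = x·e_j, and the x·e_j
-- generate M^q.  For q = 1 and 1 = u + v with u, v units, B = u and
-- y = −x·v⁻¹ give y·u − y = x.

open import Defs
open import Level using (Level; _⊔_)
open import Data.Nat using (ℕ; _≥_; s≤s)
import Data.Nat as ℕ
open import Data.Fin using (Fin; zero; suc)
open import Data.Product using (_×_; _,_; proj₁)
open import Function using (_∘_)
open import Relation.Nullary.Negation using (contradiction)
import Relation.Binary.PropositionalEquality as ≡
open import Relation.Binary.PropositionalEquality using (_≢_)
open import Relation.Binary.Bundles using (Setoid)
import Relation.Binary.Reasoning.Setoid as SetoidReasoning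
open import Algebra.Bundles using (Ring)
open import Algebra.Bundles.Raw using (RawGroup)
open import Algebra.Module.Bundles using (RightModule)

private variable a ℓ r ℓr m ℓm : Level

abelianizationSetoid : RawGroup a ℓ → Setoid a (a ⊔ ℓ)
abelianizationSetoid G = record
  { Carrier       = RawGroup.Carrier G
  ; _≈_           = AbEq G
  ; isEquivalence = record { refl = ab-refl ; sym = ab-sym ; trans = ab-trans }
  }

module MatrixProperties (R : Ring r ℓr) where
  open Ring R hiding (zero)
  open Matrices R
  open import Algebra.Properties.Semiring.Sum semiring
    using (sum; sum-cong-≋; ∑-distrib-+; *-distribˡ-sum)

  𝟙-diagonal : ∀ {q} (i : Fin q) → 𝟙 i i ≈ 1#
  𝟙-diagonal zero    = refl
  𝟙-diagonal (suc i) = 𝟙-diagonal i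

  𝟙-offDiagonal : ∀ {q} {i j : Fin q} → i ≢ j → 𝟙 i j ≈ 0#
  𝟙-offDiagonal {i = zero}  {zero}  i≢j = contradiction ≡.refl i≢j
  𝟙-offDiagonal {i = zero}  {suc j} _   = refl
  𝟙-offDiagonal {i = suc i} {zero}  _   = refl
  𝟙-offDiagonal {i = suc i} {suc j} i≢j = 𝟙-offDiagonal (i≢j ∘ ≡.cong suc)

  𝟘 : ∀ {q} → Matrix q
  𝟘 _ _ = 0#

  infixl 6 _⊕_
  _⊕_ : ∀ {q} → Matrix q → Matrix q → Matrix q
  (A ⊕ B) i j = A i j + B i j

  ≈ₘ-setoid : ℕ → Setoid r ℓr
  ≈ₘ-setoid q = record
    { Carrier       = Matrix q
    ; _≈_           = _≈ₘ_
    ; isEquivalence = record { refl = λ _ _ → refl ; sym = ≈ₘ-sym ; trans = ≈ₘ-trans }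
    }

  module ≈ₘ-Reasoning {q : ℕ} = SetoidReasoning (≈ₘ-setoid q)

  ⊕-cong : ∀ {q} {A A′ B B′ : Matrix q} → A ≈ₘ A′ → B ≈ₘ B′ → (A ⊕ B) ≈ₘ (A′ ⊕ B′)
  ⊕-cong A≈A′ B≈B′ i j = +-cong (A≈A′ i j) (B≈B′ i j)

  ⊕-congˡ : ∀ {q} {A B B′ : Matrix q} → B ≈ₘ B′ → (A ⊕ B) ≈ₘ (A ⊕ B′)
  ⊕-congˡ B≈B′ i j = +-congˡ (B≈B′ i j)

  ⊗-distribˡ-⊕ : ∀ {q} (A B C : Matrix q) → (A ⊗ (B ⊕ C)) ≈ₘ ((A ⊗ B) ⊕ (A ⊗ C))
  ⊗-distribˡ-⊕ A B C i j =
    trans (sum-cong-≋ (λ k → distribˡ (A i k) (B k j) (C k j)))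
          (∑-distrib-+ (λ k → A i k * B k j) (λ k → A i k * C k j))

  ⊗-distribʳ-⊕ : ∀ {q} (A B C : Matrix q) → ((A ⊕ B) ⊗ C) ≈ₘ ((A ⊗ C) ⊕ (B ⊗ C))
  ⊗-distribʳ-⊕ A B C i j =
    trans (sum-cong-≋ (λ k → distribʳ (C k j) (A i k) (B i k)))
          (∑-distrib-+ (λ k → A i k * C k j) (λ k → B i k * C k j))

  unitGL : ∀ {u} → IsUnit u → GLElem 1
  unitGL {u} (w , uw≈1 , wu≈1) = mkGL (λ _ _ → u) (λ _ _ → w)
    (λ { zero zero → trans (+-identityʳ _) uw≈1 })
    (λ { zero zero → trans (+-identityʳ _) wu≈1 })

  module Transvection {q} {i j : Fin q} (i≢j : i ≢ j) where

    elementary : Carrier → Matrix q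
    elementary c a b = (𝟙 a i * c) * 𝟙 j b

    elementary-⊗ : ∀ c d → (elementary c ⊗ elementary d) ≈ₘ 𝟘
    elementary-⊗ c d a b = begin
      sum (λ k → ((𝟙 a i * c) * 𝟙 j k) * elementary d k b)
        ≈⟨ sum-cong-≋ (λ k → *-assoc (𝟙 a i * c) (𝟙 j k) (elementary d k b)) ⟩
      sum (λ k → (𝟙 a i * c) * (𝟙 j k * elementary d k b))
        ≈⟨ *-distribˡ-sum (𝟙 a i * c) (λ k → 𝟙 j k * elementary d k b) ⟨
      (𝟙 a i * c) * (𝟙 ⊗ elementary d) j b
        ≈⟨ *-congˡ (⊗-identityˡ (elementary d) j b) ⟩
      (𝟙 a i * c) * ((𝟙 j i * d) * 𝟙 j b)
        ≈⟨ *-congˡ (*-congʳ (*-congʳ (𝟙-offDiagonal (i≢j ∘ ≡.sym)))) ⟩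
      (𝟙 a i * c) * ((0# * d) * 𝟙 j b)
        ≈⟨ *-congˡ (trans (*-congʳ (zeroˡ d)) (zeroˡ (𝟙 j b))) ⟩
      (𝟙 a i * c) * 0#
        ≈⟨ zeroʳ _ ⟩
      0# ∎
      where open SetoidReasoning setoid

    elementary-+ : ∀ c d → (elementary c ⊕ elementary d) ≈ₘ elementary (c + d)
    elementary-+ c d a b =
      trans (sym (distribʳ (𝟙 j b) (𝟙 a i * c) (𝟙 a i * d)))
            (*-congʳ (sym (distribˡ (𝟙 a i) c d)))

    transvection : Carrier → Matrix q
    transvection c = 𝟙 ⊕ elementary c

    transvection-+ : ∀ c d → (transvection c ⊗ transvection d) ≈ₘ transvection (c + d)
    transvection-+ c d = begin
      (𝟙 ⊕ E c) ⊗ (𝟙 ⊕ E d)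
        ≈⟨ ⊗-distribʳ-⊕ 𝟙 (E c) (𝟙 ⊕ E d) ⟩
      𝟙 ⊗ (𝟙 ⊕ E d) ⊕ E c ⊗ (𝟙 ⊕ E d)
        ≈⟨ ⊕-cong (⊗-identityˡ (𝟙 ⊕ E d)) (⊗-distribˡ-⊕ (E c) 𝟙 (E d)) ⟩
      (𝟙 ⊕ E d) ⊕ (E c ⊗ 𝟙 ⊕ E c ⊗ E d)
        ≈⟨ ⊕-congˡ (⊕-cong (⊗-identityʳ (E c)) (elementary-⊗ c d)) ⟩
      (𝟙 ⊕ E d) ⊕ (E c ⊕ 𝟘)
        ≈⟨ (λ a b → rearrange (𝟙 a b) (E d a b) (E c a b)) ⟩
      𝟙 ⊕ (E c ⊕ E d)
        ≈⟨ ⊕-congˡ (elementary-+ c d) ⟩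
      𝟙 ⊕ E (c + d) ∎
      where
      open ≈ₘ-Reasoning
      E = elementary
      rearrange : ∀ x y z → (x + y) + (z + 0#) ≈ x + (z + y)
      rearrange x y z =
        trans (+-congˡ (+-identityʳ z)) (trans (+-assoc x y z) (+-congˡ (+-comm y z)))

    transvection-inverse : ∀ {c d} → c + d ≈ 0# → (transvection c ⊗ transvection d) ≈ₘ 𝟙
    transvection-inverse {c} {d} c+d≈0 a b = begin
      (transvection c ⊗ transvection d) a b  ≈⟨ transvection-+ c d a b ⟩
      𝟙 a b + (𝟙 a i * (c + d)) * 𝟙 j b      ≈⟨ +-congˡ (*-congʳ (trans (*-congˡ c+d≈0) (zeroʳ _))) ⟩
      𝟙 a b + 0# * 𝟙 j b                     ≈⟨ +-congˡ (zeroˡ _) ⟩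
      𝟙 a b + 0#                             ≈⟨ +-identityʳ _ ⟩
      𝟙 a b                                  ∎
      where open SetoidReasoning setoid

    transvectionGL : Carrier → GLElem q
    transvectionGL c = mkGL (transvection c) (transvection (- c))
      (transvection-inverse (-‿inverseʳ c)) (transvection-inverse (-‿inverseˡ c))

    transvection-row : ∀ c k → transvection c i k ≈ 𝟙 i k + c * 𝟙 j k
    transvection-row c k = +-congˡ (*-congʳ (trans (*-congʳ (𝟙-diagonal i)) (*-identityˡ c)))

module RowVectorProperties (R : Ring r ℓr) (M : RightModule R m ℓm) where
  open Ring R hiding (zero)
  open Matrices R
  open SemiDirect R M
  open RightModule M
  open import Algebra.Properties.Semiring.Sum semiring using (sum)
  open import Algebra.Properties.CommutativeMonoid.Sum +ᴹ-commutativeMonoid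
    using () renaming (sum to sumᴹ; sum-cong-≋ to sumᴹ-cong-≋; sum-replicate-zero to sumᴹ-replicate-zero)
  open SetoidReasoning ≈ᴹ-setoid

  𝟎 : ∀ {q} → Fin q → Carrierᴹ
  𝟎 _ = 0ᴹ

  basis : ∀ {q} → Fin q → Carrierᴹ → Fin q → Carrierᴹ
  basis i x k = x *ᵣ 𝟙 i k

  *ᵣ-distribˡ-sum : ∀ {n} x (f : Fin n → Carrier) → x *ᵣ sum f ≈ᴹ sumᴹ (λ k → x *ᵣ f k)
  *ᵣ-distribˡ-sum {ℕ.zero}  x f = *ᵣ-zeroʳ x
  *ᵣ-distribˡ-sum {ℕ.suc n} x f =
    ≈ᴹ-trans (*ᵣ-distribˡ x (f zero) (sum (f ∘ suc))) (+ᴹ-congˡ (*ᵣ-distribˡ-sum x (f ∘ suc)))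

  sumᴹ-zero : ∀ {n} {f : Fin n → Carrierᴹ} → (∀ k → f k ≈ᴹ 0ᴹ) → sumᴹ f ≈ᴹ 0ᴹ
  sumᴹ-zero {n} f≈0 = ≈ᴹ-trans (sumᴹ-cong-≋ f≈0) (sumᴹ-replicate-zero n)

  ·ᵥ-zeroˡ : ∀ {q} (A : Matrix q) k → (𝟎 ·ᵥ A) k ≈ᴹ 0ᴹ
  ·ᵥ-zeroˡ A k = sumᴹ-zero (λ l → *ᵣ-zeroˡ (A l k))

  ·ᵥ-identityʳ : ∀ {q} (v : Fin q → Carrierᴹ) k → (v ·ᵥ 𝟙) k ≈ᴹ v k
  ·ᵥ-identityʳ v zero    = ≈ᴹ-trans
    (+ᴹ-cong (*ᵣ-identityʳ (v zero)) (sumᴹ-zero (λ l → *ᵣ-zeroʳ (v (suc l)))))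
    (+ᴹ-identityʳ _)
  ·ᵥ-identityʳ v (suc k) =
    ≈ᴹ-trans (+ᴹ-cong (*ᵣ-zeroʳ (v zero)) (·ᵥ-identityʳ (v ∘ suc) k)) (+ᴹ-identityˡ _)

  basis-·ᵥ : ∀ {q} i x (A : Matrix q) k → (basis i x ·ᵥ A) k ≈ᴹ x *ᵣ A i k
  basis-·ᵥ i x A k = begin
    sumᴹ (λ l → (x *ᵣ 𝟙 i l) *ᵣ A l k)  ≈⟨ sumᴹ-cong-≋ (λ l → *ᵣ-assoc x (𝟙 i l) (A l k)) ⟩
    sumᴹ (λ l → x *ᵣ (𝟙 i l * A l k))   ≈⟨ *ᵣ-distribˡ-sum x (λ l → 𝟙 i l * A l k) ⟨
    x *ᵣ (𝟙 ⊗ A) i k                    ≈⟨ *ᵣ-congˡ (⊗-identityˡ A i k) ⟩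
    x *ᵣ A i k                          ∎

module AbelianizedTranslations (R : Ring r ℓr) (M : RightModule R m ℓm) (q : ℕ) where
  open Ring R using (refl)
  open Matrices R
  open SemiDirect R M
  open RightModule M
  open RowVectorProperties R M
  open import Algebra.Properties.CommutativeMonoid.Sum +ᴹ-commutativeMonoid
    using () renaming (sum to sumᴹ)
  open import Algebra.Properties.AbelianGroup +ᴹ-abelianGroup using (ε⁻¹≈ε)
  open RawGroup (SD q) using () renaming (Carrier to SDElem; _∙_ to _∙ₛ_; ε to εₛ; _⁻¹ to _⁻¹ₛ)
  open SetoidReasoning (abelianizationSetoid (SD q))

  infix 4 _~_ _~ᴳ_
  _~_ : SDElem → SDElem → Set _
  _~_ = AbEq (SD q)

  _~ᴳ_ : GLElem q → GLElem q → Set _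
  _~ᴳ_ = AbEq (GL q)

  RowVector : Set m
  RowVector = Fin q → Carrierᴹ

  translation : RowVector → SDElem
  translation v = (1GL , v)

  pure : GLElem q → SDElem
  pure A = (A , 𝟎)

  Vanishes : RowVector → Set _
  Vanishes v = translation v ~ εₛ

  matrix-cong : ∀ {A B} v → mat A ≈ₘ mat B → (A , v) ~ (B , v)
  matrix-cong v A≈B = base (A≈B , λ _ → ≈ᴹ-refl)

  ∙-pure : ∀ A v B → ((A , v) ∙ₛ pure B) ~ (B ·GL A , v)
  ∙-pure A v B = base ((λ _ _ → refl) , λ k →
    ≈ᴹ-trans (+ᴹ-congˡ (·ᵥ-zeroˡ (mat A) k)) (+ᴹ-identityʳ (v k)))

  pure-∙-translation : ∀ B y → (pure B ∙ₛ translation y) ~ (1GL ·GL B , y ·ᵥ mat B)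
  pure-∙-translation B y = base ((λ _ _ → refl) , λ k → +ᴹ-identityˡ _)

  translation-∙ : ∀ a b → (translation a ∙ₛ translation b) ~ translation (λ k → a k +ᴹ b k)
  translation-∙ a b = base (⊗-identityʳ 𝟙 , λ k → +ᴹ-congˡ (·ᵥ-identityʳ b k))

  Vanishes-cong : ∀ {v w} → (∀ k → v k ≈ᴹ w k) → Vanishes v → Vanishes w
  Vanishes-cong v≈w = ab-trans (base ((λ _ _ → refl) , λ k → ≈ᴹ-sym (v≈w k)))

  Vanishes-+ : ∀ {a b} → Vanishes a → Vanishes b → Vanishes (λ k → a k +ᴹ b k)
  Vanishes-+ {a} {b} a~ε b~ε = begin
    translation (λ k → a k +ᴹ b k)  ≈⟨ translation-∙ a b ⟨
    translation a ∙ₛ translation b  ≈⟨ ab-∙ a~ε b~ε ⟩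
    translation 𝟎 ∙ₛ translation 𝟎  ≈⟨ translation-∙ 𝟎 𝟎 ⟩
    translation (λ _ → 0ᴹ +ᴹ 0ᴹ)    ≈⟨ Vanishes-cong (λ _ → ≈ᴹ-sym (+ᴹ-identityˡ 0ᴹ)) ab-refl ⟩
    εₛ                              ∎

  Vanishes-sum : ∀ {n} (f : Fin n → RowVector) → (∀ i → Vanishes (f i)) →
                 Vanishes (λ k → sumᴹ (λ i → f i k))
  Vanishes-sum {ℕ.zero}  f _       = ab-refl
  Vanishes-sum {ℕ.suc n} f f-vanish =
    Vanishes-+ (f-vanish zero) (Vanishes-sum (f ∘ suc) (f-vanish ∘ suc))

  translation-·ᵥ : ∀ B y → translation (y ·ᵥ mat B) ~ translation y
  translation-·ᵥ B y = begin
    translation (y ·ᵥ mat B)                     ≈⟨ matrix-cong _ (≈ₘ-sym B⁻¹[𝟙B]≈𝟙) ⟩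
    ((B ⁻¹GL) ·GL (1GL ·GL B) , y ·ᵥ mat B)      ≈⟨ ∙-pure (1GL ·GL B) (y ·ᵥ mat B) (B ⁻¹GL) ⟨
    (1GL ·GL B , y ·ᵥ mat B) ∙ₛ pure (B ⁻¹GL)    ≈⟨ ab-∙ (pure-∙-translation B y) ab-refl ⟨
    (pure B ∙ₛ translation y) ∙ₛ pure (B ⁻¹GL)   ≈⟨ ab-∙ (comm (pure B) (translation y)) ab-refl ⟩
    (translation y ∙ₛ pure B) ∙ₛ pure (B ⁻¹GL)   ≈⟨ ab-∙ (∙-pure 1GL y B) ab-refl ⟩
    (B ·GL 1GL , y) ∙ₛ pure (B ⁻¹GL)             ≈⟨ ∙-pure (B ·GL 1GL) y (B ⁻¹GL) ⟩
    ((B ⁻¹GL) ·GL (B ·GL 1GL) , y)               ≈⟨ matrix-cong y B⁻¹[B𝟙]≈𝟙 ⟩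
    translation y                                ∎
    where
    B⁻¹[𝟙B]≈𝟙 : (inv B ⊗ (𝟙 ⊗ mat B)) ≈ₘ 𝟙
    B⁻¹[𝟙B]≈𝟙 = ≈ₘ-trans (⊗-cong {A = inv B} (λ _ _ → refl) (⊗-identityˡ (mat B))) (invˡ B)
    B⁻¹[B𝟙]≈𝟙 : (inv B ⊗ (mat B ⊗ 𝟙)) ≈ₘ 𝟙
    B⁻¹[B𝟙]≈𝟙 = ≈ₘ-trans (⊗-cong {A = inv B} (λ _ _ → refl) (⊗-identityʳ (mat B))) (invˡ B)

  Vanishes-·ᵥ-difference : ∀ B y → Vanishes (λ k → (y ·ᵥ mat B) k +ᴹ -ᴹ y k)
  Vanishes-·ᵥ-difference B y = begin
    translation (λ k → (y ·ᵥ mat B) k +ᴹ -ᴹ y k)       ≈⟨ translation-∙ (y ·ᵥ mat B) -y ⟨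
    translation (y ·ᵥ mat B) ∙ₛ translation -y         ≈⟨ ab-∙ (translation-·ᵥ B y) ab-refl ⟩
    translation y ∙ₛ translation -y                    ≈⟨ translation-∙ y -y ⟩
    translation (λ k → y k +ᴹ -ᴹ y k)                  ≈⟨ Vanishes-cong y-y≈0 ab-refl ⟩
    εₛ                                                 ∎
    where
    -y = -ᴹ_ ∘ y
    y-y≈0 : ∀ k → 0ᴹ ≈ᴹ y k +ᴹ -ᴹ y k
    y-y≈0 k = ≈ᴹ-sym (-ᴹ‿inverseʳ (y k))

  projection-cong : ∀ {x y} → x ~ y → proj₁ x ~ᴳ proj₁ y
  projection-cong (base (A≈B , _)) = base A≈B
  projection-cong (comm x y)       = comm (proj₁ y) (proj₁ x)
  projection-cong ab-refl          = ab-refl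
  projection-cong (ab-sym p)       = ab-sym (projection-cong p)
  projection-cong (ab-trans p p′)  = ab-trans (projection-cong p) (projection-cong p′)
  projection-cong (ab-∙ p p′)      = ab-∙ (projection-cong p′) (projection-cong p)
  projection-cong (ab-⁻¹ p)        = ab-⁻¹ (projection-cong p)

  pure-∙ : ∀ A B → pure (A ·GL B) ~ (pure B ∙ₛ pure A)
  pure-∙ A B = ab-sym (∙-pure B 𝟎 A)

  pure-⁻¹ : ∀ A → pure (A ⁻¹GL) ~ (pure A ⁻¹ₛ)
  pure-⁻¹ A = base ((λ _ _ → refl) , λ k →
    ≈ᴹ-sym (≈ᴹ-trans (-ᴹ‿cong (·ᵥ-zeroˡ (inv A) k)) ε⁻¹≈ε))

  pure-cong : ∀ {A B} → A ~ᴳ B → pure A ~ pure B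
  pure-cong (base A≈B)      = matrix-cong 𝟎 A≈B
  pure-cong (comm A B)      =
    ab-trans (pure-∙ A B) (ab-trans (comm (pure B) (pure A)) (ab-sym (pure-∙ B A)))
  pure-cong ab-refl         = ab-refl
  pure-cong (ab-sym p)      = ab-sym (pure-cong p)
  pure-cong (ab-trans p p′) = ab-trans (pure-cong p) (pure-cong p′)
  pure-cong (ab-∙ p p′)     =
    ab-trans (pure-∙ _ _) (ab-trans (ab-∙ (pure-cong p′) (pure-cong p)) (ab-sym (pure-∙ _ _)))
  pure-cong (ab-⁻¹ {x = A} {x′ = A′} p) =
    ab-trans (pure-⁻¹ A) (ab-trans (ab-⁻¹ (pure-cong p)) (ab-sym (pure-⁻¹ A′)))

  module _ (translations-vanish : ∀ v → Vanishes v) where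

    ~-pure : ∀ A v → (A , v) ~ pure A
    ~-pure A v = begin
      (A , v)                      ≈⟨ matrix-cong v (≈ₘ-sym (⊗-identityʳ (mat A))) ⟩
      (A ·GL 1GL , v)              ≈⟨ ∙-pure 1GL v A ⟨
      translation v ∙ₛ pure A      ≈⟨ ab-∙ (translations-vanish v) ab-refl ⟩
      translation 𝟎 ∙ₛ pure A      ≈⟨ ∙-pure 1GL 𝟎 A ⟩
      (A ·GL 1GL , 𝟎)              ≈⟨ matrix-cong 𝟎 (⊗-identityʳ (mat A)) ⟩
      pure A                       ∎

    projection-injective : ∀ {x y} → proj₁ x ~ᴳ proj₁ y → x ~ y
    projection-injective {A , v} {B , w} A~B =
      ab-trans (~-pure A v) (ab-trans (pure-cong A~B) (ab-sym (~-pure B w)))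

    projectionIso : Abelianization (SD q) ≅ᴳ Abelianization (GL q)
    projectionIso = proj₁ , record
      { isGroupMonomorphism = record
        { isGroupHomomorphism = record
          { isMonoidHomomorphism = record
            { isMagmaHomomorphism = record
              { isRelHomomorphism = record { cong = projection-cong }
              ; homo = λ x y → comm (proj₁ y) (proj₁ x)
              }
            ; ε-homo = ab-refl
            }
          ; ⁻¹-homo = λ _ → ab-refl
          }
        ; injective = projection-injective
        }
      ; surjective = λ A → pure A , projection-cong
      }

module TranslationsVanish (R : Ring r ℓr) (M : RightModule R m ℓm) where
  open Ring R hiding (zero)
  open Matrices R
  open MatrixProperties R
  open SemiDirect R M
  open RightModule M
  open RowVectorProperties R M
  open import Algebra.Properties.AbelianGroup +ᴹ-abelianGroup using (xyx⁻¹≈y)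

  other : ∀ {n} → Fin (ℕ.suc (ℕ.suc n)) → Fin (ℕ.suc (ℕ.suc n))
  other zero    = suc zero
  other (suc _) = zero

  other-≢ : ∀ {n} (j : Fin (ℕ.suc (ℕ.suc n))) → other j ≢ j
  other-≢ zero    ()
  other-≢ (suc _) ()

  module _ (n : ℕ) where
    open AbelianizedTranslations R M (ℕ.suc (ℕ.suc n))

    basis-vanishes : ∀ j x → Vanishes (basis j x)
    basis-vanishes j x =
      Vanishes-cong transvected (Vanishes-·ᵥ-difference (transvectionGL 1#) (basis (other j) x))
      where
      open Transvection (other-≢ j)
      i = other j
      transvected : ∀ k → (basis i x ·ᵥ transvection 1#) k +ᴹ -ᴹ basis i x k ≈ᴹ basis j x k
      transvected k = begin
        (basis i x ·ᵥ transvection 1#) k +ᴹ -ᴹ basis i x k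
          ≈⟨ +ᴹ-congʳ (basis-·ᵥ i x (transvection 1#) k) ⟩
        x *ᵣ transvection 1# i k +ᴹ -ᴹ basis i x k
          ≈⟨ +ᴹ-congʳ (*ᵣ-congˡ (transvection-row 1# k)) ⟩
        x *ᵣ (𝟙 i k + 1# * 𝟙 j k) +ᴹ -ᴹ basis i x k
          ≈⟨ +ᴹ-congʳ (*ᵣ-distribˡ x (𝟙 i k) (1# * 𝟙 j k)) ⟩
        basis i x k +ᴹ x *ᵣ (1# * 𝟙 j k) +ᴹ -ᴹ basis i x k
          ≈⟨ xyx⁻¹≈y (basis i x k) (x *ᵣ (1# * 𝟙 j k)) ⟩
        x *ᵣ (1# * 𝟙 j k)
          ≈⟨ *ᵣ-congˡ (*-identityˡ (𝟙 j k)) ⟩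
        basis j x k ∎
        where open SetoidReasoning ≈ᴹ-setoid

    translations-vanish-2+ : ∀ v → Vanishes v
    translations-vanish-2+ v = Vanishes-cong (·ᵥ-identityʳ v)
      (Vanishes-sum (λ j → basis j (v j)) (λ j → basis-vanishes j (v j)))

  -w*u≈-w+1 : ∀ {u v w} → u + v ≈ 1# → w * v ≈ 1# → - w * u ≈ - w + 1#
  -w*u≈-w+1 {u} {v} {w} u+v≈1 wv≈1 = begin
    - w * u                    ≈⟨ +-identityʳ _ ⟨
    - w * u + 0#               ≈⟨ +-congˡ (-‿inverseˡ 1#) ⟨
    - w * u + (- 1# + 1#)      ≈⟨ +-congˡ (+-congʳ (trans (sym (-‿distribˡ-* w v)) (-‿cong wv≈1))) ⟨
    - w * u + (- w * v + 1#)   ≈⟨ +-assoc _ _ _ ⟨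
    (- w * u + - w * v) + 1#   ≈⟨ +-congʳ (distribˡ (- w) u v) ⟨
    - w * (u + v) + 1#         ≈⟨ +-congʳ (trans (*-congˡ u+v≈1) (*-identityʳ (- w))) ⟩
    - w + 1#                   ∎
    where
    open SetoidReasoning setoid
    open import Algebra.Properties.Ring R using (-‿distribˡ-*)

  translations-vanish-1 : OneIsSumOfTwoUnits → ∀ v → AbelianizedTranslations.Vanishes R M 1 v
  translations-vanish-1 (u , v , u-unit , (w , _ , wv≈1) , u+v≈1) x =
    Vanishes-cong shifted (Vanishes-·ᵥ-difference (unitGL u-unit) (λ _ → y))
    where
    open AbelianizedTranslations R M 1
    y = x zero *ᵣ - w
    shifted : ∀ k → (y *ᵣ u +ᴹ 0ᴹ) +ᴹ -ᴹ y ≈ᴹ x k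
    shifted zero = begin
      (y *ᵣ u +ᴹ 0ᴹ) +ᴹ -ᴹ y                        ≈⟨ +ᴹ-congʳ (+ᴹ-identityʳ _) ⟩
      y *ᵣ u +ᴹ -ᴹ y                                ≈⟨ +ᴹ-congʳ (*ᵣ-assoc (x zero) (- w) u) ⟩
      x zero *ᵣ (- w * u) +ᴹ -ᴹ y                   ≈⟨ +ᴹ-congʳ (*ᵣ-congˡ (-w*u≈-w+1 u+v≈1 wv≈1)) ⟩
      x zero *ᵣ (- w + 1#) +ᴹ -ᴹ y                  ≈⟨ +ᴹ-congʳ (*ᵣ-distribˡ (x zero) (- w) 1#) ⟩
      y +ᴹ x zero *ᵣ 1# +ᴹ -ᴹ y                     ≈⟨ xyx⁻¹≈y y (x zero *ᵣ 1#) ⟩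
      x zero *ᵣ 1#                                  ≈⟨ *ᵣ-identityʳ (x zero) ⟩
      x zero                                        ∎
      where open SetoidReasoning ≈ᴹ-setoid

lemma5p1 : ∀ {r ℓr m ℓm : Level} (R : Ring r ℓr) (M : RightModule R m ℓm) →
    ((q : ℕ) → q ≥ 2 →
      Abelianization (SemiDirect.SD R M q) ≅ᴳ Abelianization (Matrices.GL R q))
    × (Matrices.OneIsSumOfTwoUnits R →
      Abelianization (SemiDirect.SD R M 1) ≅ᴳ Abelianization (Matrices.GL R 1))
lemma5p1 R M =
  (λ { (ℕ.suc (ℕ.suc n)) (s≤s (s≤s _)) →
         AbelianizedTranslations.projectionIso R M (ℕ.suc (ℕ.suc n)) (translations-vanish-2+ n) })
  , λ oneIsSumOfTwoUnits →
      AbelianizedTranslations.projectionIso R M 1 (translations-vanish-1 oneIsSumOfTwoUnits)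
  where open TranslationsVanish R M
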